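{- For every integer $a\ge 2$, $$\beta_b(\overrightarrow{C}(2a-1;1,a)) = \beta_b(\overrightarrow{C}(2a-1;1,-(a-1))) = \mathrm{diam}(\overrightarrow{C}(2a-1;1,a)) = \left\lfloor\frac{2a-1}{2}\right\rfloor.$$
   Context: For integers $n\ge 3$ and $b_1,\dots,b_k$, the oriented circulant graph $\overrightarrow{C}(n;b_1,\dots,b_k)$ has vertex set $\{v_0,\dots,v_{n-1}\}$ and arc set $\{v_iv_{i+b_j} : 0\le i\le n-1,\ 1\le j\le k\}$, with subscripts taken modulo $n$ (negative $b_j$ allowed). $d(u,v)$ is the length of a shortest directed path from $u$ to $v$; $e(v)=\max_u d(v,u)$ is the eccentricity; $\mathrm{diam}$ is the maximum eccentricity. An independent broadcast on an oriented graph $\overrightarrow{G}$ is a function $f:V(\overrightarrow{G})\to\{0,\dots,\mathrm{diam}(\overrightarrow{G})\}$ with $f(v)\le e(v)$ for all $v$, and $d(u,v)>f(u)$ for all distinct $u,v$ with $f(u),f(v)>0$. Its cost is $\sigma(f)=\sum_v f(v)$, and $\beta_b(\overrightarrow{G})$ is the maximum cost of an independent broadcast on $\overrightarrow{G}$. -}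

module Defs where

open import Data.Nat as ℕ using (ℕ; zero; suc; _<_; _≤_)
open import Data.Integer as ℤ using (ℤ; +_)
open import Data.Fin using (Fin; toℕ)
open import Data.List using (List; map; allFin)
open import Data.Nat.ListAction using (sum)
open import Data.List.Membership.Propositional using (_∈_)
open import Data.Product using (Σ; ∃; _×_; _,_)
open import Relation.Nullary using (¬_)
open import Relation.Binary.PropositionalEquality using (_≡_; _≢_)

-- Oriented circulant graph C⃗(n; b₁,…,bₖ) on vertices v₀,…,v_{n-1} (represented by Fin n),
-- generators given as a list of integers (negative allowed).
Arc : (n : ℕ) → List ℤ → Fin n → Fin n → Set
Arc n bs u v = Σ ℤ λ b → b ∈ bs × Σ ℤ λ q → (+ toℕ v) ≡ (+ toℕ u) ℤ.+ b ℤ.+ q ℤ.* (+ n)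

data Walk (n : ℕ) (bs : List ℤ) : ℕ → Fin n → Fin n → Set where
  here : ∀ {u} → Walk n bs 0 u u
  step : ∀ {k u w v} → Arc n bs u w → Walk n bs k w v → Walk n bs (suc k) u v

IsDist : (n : ℕ) → List ℤ → Fin n → Fin n → ℕ → Set
IsDist n bs u v k = Walk n bs k u v × (∀ m → m < k → ¬ Walk n bs m u v)

IsEcc : (n : ℕ) → List ℤ → Fin n → ℕ → Set
IsEcc n bs v e =
  (∀ u → Σ ℕ λ k → IsDist n bs v u k × k ≤ e) × (Σ (Fin n) λ u → IsDist n bs v u e)

IsDiam : (n : ℕ) → List ℤ → ℕ → Set
IsDiam n bs D =
  (∀ v → Σ ℕ λ e → IsEcc n bs v e × e ≤ D) × (Σ (Fin n) λ v → IsEcc n bs v D)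

IsIndepBroadcast : (n : ℕ) → List ℤ → (Fin n → ℕ) → Set
IsIndepBroadcast n bs f =
  (∀ v e → IsEcc n bs v e → f v ≤ e) ×
  (∀ u v → u ≢ v → 0 < f u → 0 < f v → ∀ k → IsDist n bs u v k → f u < k)

cost : (n : ℕ) → (Fin n → ℕ) → ℕ
cost n f = sum (map f (allFin n))

IsBroadcastIndepNumber : (n : ℕ) → List ℤ → ℕ → Set
IsBroadcastIndepNumber n bs β =
  (Σ (Fin n → ℕ) λ f → IsIndepBroadcast n bs f × cost n f ≡ β) ×
  (∀ f → IsIndepBroadcast n bs f → cost n f ≤ β)

{-# OPTIONS --safe #-}
-- Write a = m + 1, so n = 2a − 1 = 2m + 1.  Since 2a ≡ 1 (mod n), doubling the vertex labels
-- turns the steps 1 and a into steps 2 and 1; and −(a − 1) ≡ a, so both generator lists give the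
-- same arcs.  Hence d(u,v) = ⌈δ/2⌉, where δ ∈ [0, n) is the residue of 2(v − u): a walk of
-- length k moves 2(v − u) by at most 2k, and 1-steps plus at most one a-step realise ⌈δ/2⌉.
-- So every eccentricity is m, which also makes broadcasting m from a single vertex independent.
-- Conversely, give each vertex u the block of residues 2u, 2u + 1, …, 2u + 2f(u) − 1.  If the
-- blocks of broadcasting u ≠ v met, 2u + i ≡ 2v + j with j ≤ i < 2f(u) would give
-- d(u,v) ≤ ⌈(i − j)/2⌉ ≤ f(u).  So the blocks are disjoint, 2σ(f) ≤ n = 2m + 1 and σ(f) ≤ m.
module Submission where

open import Defs
open import Data.Nat using (ℕ; _≤_; _*_; _∸_; _/_)
open import Data.Integer using (+_; -_)
open import Data.List using (_∷_; [])
open import Data.Product using (_×_)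

open import Data.Nat using (zero; suc; _+_; _<_; z≤n; s≤s; z<s; NonZero; ⌈_/2⌉; ⌊_/2⌋)
import Data.Nat.Properties as ℕₚ
open import Data.Nat.DivMod using (_%_; m%n≤m; m<n⇒m%n≡m; [m+kn]%n≡m%n; /-congˡ; m/n≡1+[m∸n]/n)
open import Data.Integer as ℤ using (ℤ; -[1+_])
import Data.Integer.Properties as ℤₚ
open import Data.Integer.DivMod using (_%ℕ_; n%ℕd<d; a≡a%ℕn+[a/ℕn]*n)
open import Data.Integer.Tactic.RingSolver using (solve-∀)
open import Data.Fin as Fin using (Fin; toℕ; fromℕ<)
import Data.Fin.Properties as Finₚ
open import Data.List using (List; length; lookup; tabulate; concatMap; allFin; map; _++_)
import Data.List.Properties as Listₚ
open import Data.List.Membership.Propositional using (_∈_)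
open import Data.List.Membership.Propositional.Properties using (∈-lookup; ∈-tabulate⁻)
open import Data.List.Relation.Unary.Any using (here; there)
import Data.List.Relation.Unary.All as All
import Data.List.Relation.Unary.All.Properties as Allₚ
import Data.List.Relation.Unary.AllPairs as AllPairs
import Data.List.Relation.Unary.AllPairs.Properties as AllPairsₚ
open import Data.List.Relation.Unary.Unique.Propositional using (Unique)
import Data.List.Relation.Unary.Unique.Propositional.Properties as Uniqueₚ
open import Data.List.Relation.Binary.Disjoint.Propositional using (Disjoint)
open import Data.Nat.ListAction using (sum)
open import Data.Product using (Σ; _,_; proj₁; proj₂)
open import Data.Sum using (_⊎_; inj₁; inj₂)
open import Relation.Nullary using (contradiction)
open import Relation.Binary.Bundles using (Setoid)
open import Relation.Binary.Structures using (IsEquivalence)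
import Relation.Binary.Reasoning.Setoid
open import Relation.Binary.PropositionalEquality
open import Algebra.Properties.CommutativeSemigroup ℕₚ.+-commutativeSemigroup using (interchange)

infix 4 _≡_[mod_]

record _≡_[mod_] (x y : ℤ) (n : ℕ) : Set where
  constructor congruent
  field
    quotient : ℤ
    equation : x ≡ y ℤ.+ quotient ℤ.* + n

open _≡_[mod_] using (quotient; equation)

module _ {n : ℕ} where

  ≡[mod]-reflexive : ∀ {x y} → x ≡ y → x ≡ y [mod n ]
  ≡[mod]-reflexive {x} refl = congruent (+ 0) (no-shift x (+ n))
    where
    no-shift : ∀ x n → x ≡ x ℤ.+ + 0 ℤ.* n
    no-shift = solve-∀

  ≡[mod]-refl : ∀ {x} → x ≡ x [mod n ]
  ≡[mod]-refl = ≡[mod]-reflexive refl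

  ≡[mod]-sym : ∀ {x y} → x ≡ y [mod n ] → y ≡ x [mod n ]
  ≡[mod]-sym {y = y} (congruent q x≡y+qn) =
    congruent (ℤ.- q) (trans (unshift y q (+ n)) (cong (ℤ._+ ℤ.- q ℤ.* + n) (sym x≡y+qn)))
    where
    unshift : ∀ y q n → y ≡ y ℤ.+ q ℤ.* n ℤ.+ ℤ.- q ℤ.* n
    unshift = solve-∀

  ≡[mod]-trans : ∀ {x y z} → x ≡ y [mod n ] → y ≡ z [mod n ] → x ≡ z [mod n ]
  ≡[mod]-trans {z = z} (congruent q refl) (congruent r refl) = congruent (r ℤ.+ q) (shifts z q r (+ n))
    where
    shifts : ∀ z q r n → z ℤ.+ r ℤ.* n ℤ.+ q ℤ.* n ≡ z ℤ.+ (r ℤ.+ q) ℤ.* n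
    shifts = solve-∀

  ≡[mod]-+ : ∀ {x y x′ y′} → x ≡ y [mod n ] → x′ ≡ y′ [mod n ] → x ℤ.+ x′ ≡ y ℤ.+ y′ [mod n ]
  ≡[mod]-+ {y = y} {y′ = y′} (congruent q refl) (congruent q′ refl) =
    congruent (q ℤ.+ q′) (shifts y y′ q q′ (+ n))
    where
    shifts : ∀ y y′ q q′ n → y ℤ.+ q ℤ.* n ℤ.+ (y′ ℤ.+ q′ ℤ.* n) ≡ y ℤ.+ y′ ℤ.+ (q ℤ.+ q′) ℤ.* n
    shifts = solve-∀

  ≡[mod]-+ˡ : ∀ z {x y} → x ≡ y [mod n ] → z ℤ.+ x ≡ z ℤ.+ y [mod n ]
  ≡[mod]-+ˡ z = ≡[mod]-+ (≡[mod]-refl {z})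

  ≡[mod]-+ʳ : ∀ z {x y} → x ≡ y [mod n ] → x ℤ.+ z ≡ y ℤ.+ z [mod n ]
  ≡[mod]-+ʳ z x≡y = ≡[mod]-+ x≡y (≡[mod]-refl {z})

  ≡[mod]-*ˡ : ∀ c {x y} → x ≡ y [mod n ] → c ℤ.* x ≡ c ℤ.* y [mod n ]
  ≡[mod]-*ˡ c {y = y} (congruent q refl) = congruent (c ℤ.* q) (scale c y q (+ n))
    where
    scale : ∀ c y q n → c ℤ.* (y ℤ.+ q ℤ.* n) ≡ c ℤ.* y ℤ.+ c ℤ.* q ℤ.* n
    scale = solve-∀

  ≡[mod]-isEquivalence : IsEquivalence (λ x y → x ≡ y [mod n ])
  ≡[mod]-isEquivalence = record { refl = ≡[mod]-refl ; sym = ≡[mod]-sym ; trans = ≡[mod]-trans }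

≡[mod]-setoid : ℕ → Setoid _ _
≡[mod]-setoid n = record { isEquivalence = ≡[mod]-isEquivalence {n} }

module ≡[mod]-Reasoning (n : ℕ) = Relation.Binary.Reasoning.Setoid (≡[mod]-setoid n)

≡[mod]-+-cancelˡ : ∀ {n} z {x y} → z ℤ.+ x ≡ z ℤ.+ y [mod n ] → x ≡ y [mod n ]
≡[mod]-+-cancelˡ {n} z {x} {y} z+x≡z+y = begin
  x                     ≡⟨ cancel z x ⟨
  ℤ.- z ℤ.+ (z ℤ.+ x)   ≈⟨ ≡[mod]-+ˡ (ℤ.- z) z+x≡z+y ⟩
  ℤ.- z ℤ.+ (z ℤ.+ y)   ≡⟨ cancel z y ⟩
  y                     ∎
  where
  open ≡[mod]-Reasoning n
  cancel : ∀ z x → ℤ.- z ℤ.+ (z ℤ.+ x) ≡ x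
  cancel = solve-∀


module _ {n : ℕ} .{{_ : NonZero n}} where

  %ℕ-≡[mod] : ∀ x → + (x %ℕ n) ≡ x [mod n ]
  %ℕ-≡[mod] x = ≡[mod]-sym (congruent (x ℤ./ℕ n) (a≡a%ℕn+[a/ℕn]*n x n))

  private
    shift⇒%-≡ : ∀ {x y} k → + x ≡ + y ℤ.+ + k ℤ.* + n → x % n ≡ y % n
    shift⇒%-≡ {x} {y} k eq = begin
      x % n           ≡⟨ cong (_% n) (ℤₚ.+-injective (trans eq (sym +[y+kn]))) ⟩
      (y + k * n) % n ≡⟨ [m+kn]%n≡m%n y k n ⟩
      y % n           ∎
      where
      open ≡-Reasoning
      +[y+kn] : + (y + k * n) ≡ + y ℤ.+ + k ℤ.* + n
      +[y+kn] = trans (ℤₚ.pos-+ y (k * n)) (cong (λ t → + y ℤ.+ t) (ℤₚ.pos-* k n))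

  ≡[mod]⇒%-≡ : ∀ {x y} → + x ≡ + y [mod n ] → x % n ≡ y % n
  ≡[mod]⇒%-≡ (congruent (+ k) eq)    = shift⇒%-≡ k eq
  ≡[mod]⇒%-≡ (congruent -[1+ k ] eq) =
    sym (shift⇒%-≡ (suc k) (equation (≡[mod]-sym {n} (congruent -[1+ k ] eq))))

  ≡[mod]⇒%ℕ-≡ : ∀ {x y} → + y ≡ x [mod n ] → x %ℕ n ≡ y % n
  ≡[mod]⇒%ℕ-≡ {x} {y} y≡x = begin
    x %ℕ n     ≡⟨ m<n⇒m%n≡m (n%ℕd<d x n) ⟨
    x %ℕ n % n ≡⟨ ≡[mod]⇒%-≡ (≡[mod]-trans (%ℕ-≡[mod] x) (≡[mod]-sym y≡x)) ⟩
    y % n      ∎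
    where open ≡-Reasoning

  <-≡[mod]⇒≡ : ∀ {x y} → x < n → y < n → + x ≡ + y [mod n ] → x ≡ y
  <-≡[mod]⇒≡ {x} {y} x<n y<n x≡y = begin
    x     ≡⟨ m<n⇒m%n≡m x<n ⟨
    x % n ≡⟨ ≡[mod]⇒%-≡ x≡y ⟩
    y % n ≡⟨ m<n⇒m%n≡m y<n ⟩
    y     ∎
    where open ≡-Reasoning

  toℕ-≡[mod]⇒≡ : ∀ {u v : Fin n} → + toℕ u ≡ + toℕ v [mod n ] → u ≡ v
  toℕ-≡[mod]⇒≡ {u} {v} u≡v = Finₚ.toℕ-injective (<-≡[mod]⇒≡ (Finₚ.toℕ<n u) (Finₚ.toℕ<n v) u≡v)

  residue : ℤ → Fin n
  residue x = fromℕ< (n%ℕd<d x n)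

  residue-≡[mod] : ∀ x → + toℕ (residue x) ≡ x [mod n ]
  residue-≡[mod] x = subst (λ r → + r ≡ x [mod n ]) (sym (Finₚ.toℕ-fromℕ< _)) (%ℕ-≡[mod] x)

  residue-≡⇒≡[mod] : ∀ {x y} → residue x ≡ residue y → x ≡ y [mod n ]
  residue-≡⇒≡[mod] {x} {y} eq = ≡[mod]-trans (≡[mod]-sym (residue-≡[mod] x))
    (subst (λ r → + toℕ r ≡ y [mod n ]) (sym eq) (residue-≡[mod] y))

arc : ∀ {n bs b s} {u w : Fin n} → b ∈ bs → b ≡ s [mod n ] →
      + toℕ w ≡ + toℕ u ℤ.+ s [mod n ] → Arc n bs u w
arc {n} {b = b} {u = u} {w} b∈bs b≡s w≡u+s = b , b∈bs , quotient w≡u+b , equation w≡u+b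
  where
  w≡u+b : + toℕ w ≡ + toℕ u ℤ.+ b [mod n ]
  w≡u+b = ≡[mod]-trans w≡u+s (≡[mod]-+ˡ (+ toℕ u) (≡[mod]-sym b≡s))

arc-offset : ∀ {n bs} {u w : Fin n} → Arc n bs u w →
             Σ ℤ λ b → b ∈ bs × + toℕ w ≡ + toℕ u ℤ.+ b [mod n ]
arc-offset (b , b∈bs , q , eq) = b , b∈bs , congruent q eq

Unique-lookup-injective : ∀ {A : Set} {xs : List A} → Unique xs →
                          ∀ {i j} → lookup xs i ≡ lookup xs j → i ≡ j
Unique-lookup-injective (_ AllPairs.∷ _) {Fin.zero} {Fin.zero} _ = refl
Unique-lookup-injective (x∉xs AllPairs.∷ _) {Fin.zero} {Fin.suc j} eq =
  contradiction eq (All.lookup x∉xs (∈-lookup j))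
Unique-lookup-injective (x∉xs AllPairs.∷ _) {Fin.suc i} {Fin.zero} eq =
  contradiction (sym eq) (All.lookup x∉xs (∈-lookup i))
Unique-lookup-injective (_ AllPairs.∷ xs!) {Fin.suc i} {Fin.suc j} eq =
  cong Fin.suc (Unique-lookup-injective xs! eq)

Unique⇒length≤ : ∀ {n} {xs : List (Fin n)} → Unique xs → length xs ≤ n
Unique⇒length≤ {xs = xs} xs! = ℕₚ.≮⇒≥ λ n<length →
  let i , j , i<j , xsᵢ≡xsⱼ = Finₚ.pigeonhole n<length (lookup xs)
  in Finₚ.<⇒≢ i<j (Unique-lookup-injective xs! xsᵢ≡xsⱼ)

⌈n/2⌉≤m : ∀ {n m} → n ≤ m + m → ⌈ n /2⌉ ≤ m
⌈n/2⌉≤m {m = m} n≤m+m = ℕₚ.≤-trans (ℕₚ.⌈n/2⌉-mono n≤m+m) (ℕₚ.≤-reflexive (sym (ℕₚ.n≡⌈n+n/2⌉ m)))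

Fin[n+n]⇒0<n : ∀ {n} → Fin (n + n) → 0 < n
Fin[n+n]⇒0<n {suc n} _ = z<s

module Circulant (m : ℕ) where

  N a : ℕ
  N = suc (m + m)
  a = suc m

  ⌜_⌝ : Fin N → ℤ
  ⌜ u ⌝ = + toℕ u

  2a≡1 : + 2 ℤ.* + a ≡ + 1 [mod N ]
  2a≡1 = congruent (+ 1) (identity (+ m))
    where
    identity : ∀ x → + 2 ℤ.* (+ 1 ℤ.+ x) ≡ + 1 ℤ.+ + 1 ℤ.* (+ 1 ℤ.+ (x ℤ.+ x))
    identity = solve-∀

  -m≡a : ℤ.- (+ m) ≡ + a [mod N ]
  -m≡a = congruent (ℤ.- (+ 1)) (identity (+ m))
    where
    identity : ∀ x → ℤ.- x ≡ (+ 1 ℤ.+ x) ℤ.+ ℤ.- (+ 1) ℤ.* (+ 1 ℤ.+ (x ℤ.+ x))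
    identity = solve-∀

  diff₂ : Fin N → Fin N → ℤ
  diff₂ u v = + 2 ℤ.* (⌜ v ⌝ ℤ.- ⌜ u ⌝)

  δ : Fin N → Fin N → ℕ
  δ u v = diff₂ u v %ℕ N

  dist : Fin N → Fin N → ℕ
  dist u v = ⌈ δ u v /2⌉

  diff₂-trans : ∀ u w v → diff₂ u w ℤ.+ diff₂ w v ≡ diff₂ u v
  diff₂-trans u w v = identity ⌜ u ⌝ ⌜ w ⌝ ⌜ v ⌝
    where
    identity : ∀ u w v → + 2 ℤ.* (w ℤ.- u) ℤ.+ + 2 ℤ.* (v ℤ.- w) ≡ + 2 ℤ.* (v ℤ.- u)
    identity = solve-∀

  diff₂-self : ∀ u → diff₂ u u ≡ + 0
  diff₂-self u = identity ⌜ u ⌝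
    where
    identity : ∀ u → + 2 ℤ.* (u ℤ.- u) ≡ + 0
    identity = solve-∀

  diff₂-step : ∀ {u w s} → ⌜ w ⌝ ≡ ⌜ u ⌝ ℤ.+ s [mod N ] → diff₂ u w ≡ + 2 ℤ.* s [mod N ]
  diff₂-step {u} {w} {s} w≡u+s = begin
    + 2 ℤ.* (⌜ w ⌝ ℤ.- ⌜ u ⌝)         ≈⟨ ≡[mod]-*ˡ (+ 2) (≡[mod]-+ʳ (ℤ.- ⌜ u ⌝) w≡u+s) ⟩
    + 2 ℤ.* (⌜ u ⌝ ℤ.+ s ℤ.- ⌜ u ⌝)   ≡⟨ identity ⌜ u ⌝ s ⟩
    + 2 ℤ.* s                         ∎
    where
    open ≡[mod]-Reasoning N
    identity : ∀ u s → + 2 ℤ.* (u ℤ.+ s ℤ.- u) ≡ + 2 ℤ.* s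
    identity = solve-∀

  δ-≡[mod] : ∀ u v → + δ u v ≡ diff₂ u v [mod N ]
  δ-≡[mod] u v = %ℕ-≡[mod] (diff₂ u v)

  δ-≤ : ∀ u v {y} → + y ≡ diff₂ u v [mod N ] → δ u v ≤ y
  δ-≤ u v {y} y≡diff₂ = subst (_≤ y) (sym (≡[mod]⇒%ℕ-≡ y≡diff₂)) (m%n≤m y N)

  dist≤m : ∀ u v → dist u v ≤ m
  dist≤m u v = ⌈n/2⌉≤m (ℕₚ.≤-pred (n%ℕd<d (diff₂ u v) N))

  far : Fin N → Fin N
  far v = residue (⌜ v ⌝ ℤ.+ + m)

  dist-far : ∀ v → dist v (far v) ≡ m
  dist-far v = trans (cong ⌈_/2⌉ δ-far) (sym (ℕₚ.n≡⌈n+n/2⌉ m))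
    where
    double : ∀ x → + 2 ℤ.* x ≡ x ℤ.+ x
    double = solve-∀
    δ-far : δ v (far v) ≡ m + m
    δ-far = trans (≡[mod]⇒%ℕ-≡ (≡[mod]-sym (≡[mod]-trans (diff₂-step {v} {far v} (residue-≡[mod] _))
                                                          (≡[mod]-reflexive (double (+ m))))))
                  (m<n⇒m%n≡m (ℕₚ.n<1+n (m + m)))

  overlap⇒dist≤ : ∀ {u v r} j d → d ≤ r + r →
                  + 2 ℤ.* ⌜ u ⌝ ℤ.+ + (j + d) ≡ + 2 ℤ.* ⌜ v ⌝ ℤ.+ + j [mod N ] → dist u v ≤ r
  overlap⇒dist≤ {u} {v} j d d≤r+r same-token = ⌈n/2⌉≤m (ℕₚ.≤-trans (δ-≤ u v d≡diff₂) d≤r+r)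
    where
    open ≡[mod]-Reasoning N
    split : ∀ x j d → d ≡ x ℤ.+ (j ℤ.+ d) ℤ.- (x ℤ.+ j)
    split = solve-∀
    rejoin : ∀ u v j → + 2 ℤ.* v ℤ.+ j ℤ.- (+ 2 ℤ.* u ℤ.+ j) ≡ + 2 ℤ.* (v ℤ.- u)
    rejoin = solve-∀
    d≡diff₂ : + d ≡ diff₂ u v [mod N ]
    d≡diff₂ = begin
      + d                                                      ≡⟨ split (+ 2 ℤ.* ⌜ u ⌝) (+ j) (+ d) ⟩
      + 2 ℤ.* ⌜ u ⌝ ℤ.+ + (j + d) ℤ.- (+ 2 ℤ.* ⌜ u ⌝ ℤ.+ + j) ≈⟨ ≡[mod]-+ʳ _ same-token ⟩
      + 2 ℤ.* ⌜ v ⌝ ℤ.+ + j ℤ.- (+ 2 ℤ.* ⌜ u ⌝ ℤ.+ + j)       ≡⟨ rejoin ⌜ u ⌝ ⌜ v ⌝ (+ j) ⟩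
      diff₂ u v                                                ∎

  record Generates1a (bs : List ℤ) : Set where
    field
      step-1 : Σ ℤ λ b → b ∈ bs × b ≡ + 1 [mod N ]
      step-a : Σ ℤ λ b → b ∈ bs × b ≡ + a [mod N ]
      steps  : ∀ {b} → b ∈ bs → b ≡ + 1 [mod N ] ⊎ b ≡ + a [mod N ]

  module Graph {bs : List ℤ} (gen : Generates1a bs) where
    open Generates1a gen

    arc-1 : ∀ {u w} → ⌜ w ⌝ ≡ ⌜ u ⌝ ℤ.+ + 1 [mod N ] → Arc N bs u w
    arc-1 = let _ , b∈bs , b≡1 = step-1 in arc b∈bs b≡1

    arc-a : ∀ {u w} → ⌜ w ⌝ ≡ ⌜ u ⌝ ℤ.+ + a [mod N ] → Arc N bs u w
    arc-a = let _ , b∈bs , b≡a = step-a in arc b∈bs b≡a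

    arc-diff₂ : ∀ {u w} → Arc N bs u w → Σ ℕ λ c → c ≤ 2 × + c ≡ diff₂ u w [mod N ]
    arc-diff₂ {u} {w} uw with arc-offset uw
    ... | b , b∈bs , w≡u+b with steps b∈bs
    ... | inj₁ b≡1 = 2 , ℕₚ.≤-refl , ≡[mod]-sym (begin
      diff₂ u w   ≈⟨ diff₂-step w≡u+b ⟩
      + 2 ℤ.* b   ≈⟨ ≡[mod]-*ˡ (+ 2) b≡1 ⟩
      + 2         ∎)
      where open ≡[mod]-Reasoning N
    ... | inj₂ b≡a = 1 , ℕₚ.n≤1+n 1 , ≡[mod]-sym (begin
      diff₂ u w   ≈⟨ diff₂-step w≡u+b ⟩
      + 2 ℤ.* b   ≈⟨ ≡[mod]-*ˡ (+ 2) b≡a ⟩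
      + 2 ℤ.* + a ≈⟨ 2a≡1 ⟩
      + 1         ∎)
      where open ≡[mod]-Reasoning N

    walk-diff₂ : ∀ {k u v} → Walk N bs k u v → Σ ℕ λ y → y ≤ k + k × + y ≡ diff₂ u v [mod N ]
    walk-diff₂ {u = u} here = 0 , z≤n , ≡[mod]-reflexive (sym (diff₂-self u))
    walk-diff₂ (step {k} {u} {w} {v} uw wv) with arc-diff₂ uw | walk-diff₂ wv
    ... | c , c≤2 , c≡ | y , y≤k+k , y≡ = c + y , c+y≤ , (begin
      + c ℤ.+ + y              ≈⟨ ≡[mod]-+ c≡ y≡ ⟩
      diff₂ u w ℤ.+ diff₂ w v  ≡⟨ diff₂-trans u w v ⟩
      diff₂ u v                ∎)
      where
      open ≡[mod]-Reasoning N
      c+y≤ : c + y ≤ suc k + suc k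
      c+y≤ = ℕₚ.≤-trans (ℕₚ.+-mono-≤ c≤2 y≤k+k) (ℕₚ.≤-reflexive (cong suc (sym (ℕₚ.+-suc k k))))

    dist-≤ : ∀ {k u v} → Walk N bs k u v → dist u v ≤ k
    dist-≤ {u = u} {v} uv with walk-diff₂ uv
    ... | y , y≤k+k , y≡ = ⌈n/2⌉≤m (ℕₚ.≤-trans (δ-≤ u v y≡) y≤k+k)

    walk-halving : ∀ X {u v} → ⌜ v ⌝ ≡ ⌜ u ⌝ ℤ.+ + a ℤ.* + X [mod N ] → Walk N bs ⌈ X /2⌉ u v
    walk-halving 0 {u} {v} v≡u+0 = subst (Walk N bs 0 u) (toℕ-≡[mod]⇒≡ u≡v) here
      where
      identity : ∀ u x → u ℤ.+ x ℤ.* + 0 ≡ u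
      identity = solve-∀
      u≡v : ⌜ u ⌝ ≡ ⌜ v ⌝ [mod N ]
      u≡v = ≡[mod]-sym (≡[mod]-trans v≡u+0 (≡[mod]-reflexive (identity ⌜ u ⌝ (+ a))))
    walk-halving 1 {u} v≡u+a·1 =
      step (arc-a (≡[mod]-trans v≡u+a·1 (≡[mod]-reflexive (identity ⌜ u ⌝ (+ a))))) here
      where
      identity : ∀ u x → u ℤ.+ x ℤ.* + 1 ≡ u ℤ.+ x
      identity = solve-∀
    walk-halving (suc (suc X)) {u} {v} v≡u+a[2+X] =
      step (arc-1 w≡u+1) (walk-halving X v≡w+aX)
      where
      open ≡[mod]-Reasoning N
      w : Fin N
      w = residue (⌜ u ⌝ ℤ.+ + 1)
      w≡u+1 : ⌜ w ⌝ ≡ ⌜ u ⌝ ℤ.+ + 1 [mod N ]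
      w≡u+1 = residue-≡[mod] (⌜ u ⌝ ℤ.+ + 1)
      regroup : ∀ u x X → u ℤ.+ x ℤ.* (+ 2 ℤ.+ X) ≡ u ℤ.+ + 2 ℤ.* x ℤ.+ x ℤ.* X
      regroup = solve-∀
      v≡w+aX : ⌜ v ⌝ ≡ ⌜ w ⌝ ℤ.+ + a ℤ.* + X [mod N ]
      v≡w+aX = begin
        ⌜ v ⌝                                 ≈⟨ v≡u+a[2+X] ⟩
        ⌜ u ⌝ ℤ.+ + a ℤ.* (+ 2 ℤ.+ + X)       ≡⟨ regroup ⌜ u ⌝ (+ a) (+ X) ⟩
        ⌜ u ⌝ ℤ.+ + 2 ℤ.* + a ℤ.+ + a ℤ.* + X ≈⟨ ≡[mod]-+ʳ (+ a ℤ.* + X) (≡[mod]-+ˡ ⌜ u ⌝ 2a≡1) ⟩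
        ⌜ u ⌝ ℤ.+ + 1 ℤ.+ + a ℤ.* + X         ≈⟨ ≡[mod]-+ʳ (+ a ℤ.* + X) (≡[mod]-sym w≡u+1) ⟩
        ⌜ w ⌝ ℤ.+ + a ℤ.* + X                 ∎

    v≡u+aδ : ∀ u v → ⌜ v ⌝ ≡ ⌜ u ⌝ ℤ.+ + a ℤ.* + δ u v [mod N ]
    v≡u+aδ u v = ≡[mod]-sym (begin
      ⌜ u ⌝ ℤ.+ + a ℤ.* + δ u v                     ≈⟨ ≡[mod]-+ˡ ⌜ u ⌝ (≡[mod]-*ˡ (+ a) (δ-≡[mod] u v)) ⟩
      ⌜ u ⌝ ℤ.+ + a ℤ.* diff₂ u v                   ≡⟨ regroup ⌜ u ⌝ ⌜ v ⌝ (+ a) ⟩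
      ⌜ u ⌝ ℤ.+ (⌜ v ⌝ ℤ.- ⌜ u ⌝) ℤ.* (+ 2 ℤ.* + a) ≈⟨ ≡[mod]-+ˡ ⌜ u ⌝ (≡[mod]-*ˡ (⌜ v ⌝ ℤ.- ⌜ u ⌝) 2a≡1) ⟩
      ⌜ u ⌝ ℤ.+ (⌜ v ⌝ ℤ.- ⌜ u ⌝) ℤ.* + 1           ≡⟨ cancel ⌜ u ⌝ ⌜ v ⌝ ⟩
      ⌜ v ⌝                                         ∎)
      where
      open ≡[mod]-Reasoning N
      regroup : ∀ u v x → u ℤ.+ x ℤ.* (+ 2 ℤ.* (v ℤ.- u)) ≡ u ℤ.+ (v ℤ.- u) ℤ.* (+ 2 ℤ.* x)
      regroup = solve-∀
      cancel : ∀ u v → u ℤ.+ (v ℤ.- u) ℤ.* + 1 ≡ v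
      cancel = solve-∀

    dist-walk : ∀ u v → Walk N bs (dist u v) u v
    dist-walk u v = walk-halving (δ u v) (v≡u+aδ u v)

    dist-isDist : ∀ u v → IsDist N bs u v (dist u v)
    dist-isDist u v = dist-walk u v , λ k k<dist uv → ℕₚ.<⇒≱ k<dist (dist-≤ uv)

    isDist⇒≡dist : ∀ {u v k} → IsDist N bs u v k → k ≡ dist u v
    isDist⇒≡dist {u} {v} (uv , shortest) =
      ℕₚ.≤-antisym (ℕₚ.≮⇒≥ λ dist<k → shortest (dist u v) dist<k (dist-walk u v)) (dist-≤ uv)

    isEcc : ∀ v → IsEcc N bs v m
    isEcc v = (λ u → dist v u , dist-isDist v u , dist≤m v u) ,
              far v , subst (IsDist N bs v (far v)) (dist-far v) (dist-isDist v (far v))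

    isEcc⇒m≤ : ∀ {v e} → IsEcc N bs v e → m ≤ e
    isEcc⇒m≤ {v} (bounded , _) with bounded (far v)
    ... | k , v→far , k≤e = subst (_≤ _) (trans (isDist⇒≡dist v→far) (dist-far v)) k≤e

    isDiam : IsDiam N bs m
    isDiam = (λ v → m , isEcc v , ℕₚ.≤-refl) , Fin.zero , isEcc Fin.zero

    m-at-v₀ : Fin N → ℕ
    m-at-v₀ Fin.zero    = m
    m-at-v₀ (Fin.suc _) = 0

    m-at-v₀-indep : IsIndepBroadcast N bs m-at-v₀
    m-at-v₀-indep = within-ecc , alone
      where
      within-ecc : ∀ v e → IsEcc N bs v e → m-at-v₀ v ≤ e
      within-ecc Fin.zero    e ecc = isEcc⇒m≤ ecc
      within-ecc (Fin.suc _) e ecc = z≤n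
      alone : ∀ u v → u ≢ v → 0 < m-at-v₀ u → 0 < m-at-v₀ v → ∀ k → IsDist N bs u v k → m-at-v₀ u < k
      alone Fin.zero    Fin.zero    u≢v _ _ = contradiction refl u≢v
      alone Fin.zero    (Fin.suc _) _   _ ()
      alone (Fin.suc _) _           _   ()

    cost-m-at-v₀ : cost N m-at-v₀ ≡ m
    cost-m-at-v₀ = begin
      cost N m-at-v₀                           ≡⟨⟩
      m + sum (map m-at-v₀ (tabulate Fin.suc)) ≡⟨ cong (λ xs → m + sum xs)
                                                        (Listₚ.map-tabulate Fin.suc m-at-v₀) ⟩
      m + sum (tabulate {n = m + m} (λ _ → 0)) ≡⟨ cong (λ s → m + s) (sum-zeros (m + m)) ⟩
      m + 0                                    ≡⟨ ℕₚ.+-identityʳ m ⟩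
      m                                        ∎
      where
      open ≡-Reasoning
      sum-zeros : ∀ k → sum (tabulate {n = k} (λ _ → 0)) ≡ 0
      sum-zeros zero    = refl
      sum-zeros (suc k) = sum-zeros k

    module _ {f : Fin N → ℕ} (indep : IsIndepBroadcast N bs f) where

      f≤m : ∀ u → f u ≤ m
      f≤m u = proj₁ indep u m (isEcc u)

      token : (u : Fin N) → Fin (f u + f u) → Fin N
      token u i = residue (+ 2 ℤ.* ⌜ u ⌝ ℤ.+ + toℕ i)

      block : Fin N → List (Fin N)
      block u = tabulate (token u)

      token-injective : ∀ u {i j} → token u i ≡ token u j → i ≡ j
      token-injective u {i} {j} eq =
        Finₚ.toℕ-injective (<-≡[mod]⇒≡ (<N i) (<N j)
          (≡[mod]-+-cancelˡ (+ 2 ℤ.* ⌜ u ⌝) (residue-≡⇒≡[mod] eq)))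
        where
        <N : (i : Fin (f u + f u)) → toℕ i < N
        <N i = ℕₚ.m<n⇒m<1+n (ℕₚ.<-≤-trans (Finₚ.toℕ<n i) (ℕₚ.+-mono-≤ (f≤m u) (f≤m u)))

      token-≢ : ∀ {u v} → u ≢ v → (i : Fin (f u + f u)) (j : Fin (f v + f v)) →
                toℕ j ≤ toℕ i → token u i ≢ token v j
      token-≢ {u} {v} u≢v i j j≤i uᵢ≡vⱼ = ℕₚ.<⇒≱ apart close
        where
        apart : f u < dist u v
        apart = proj₂ indep u v u≢v (Fin[n+n]⇒0<n i) (Fin[n+n]⇒0<n j) (dist u v) (dist-isDist u v)
        d : ℕ
        d = toℕ i ∸ toℕ j
        d≤ : d ≤ f u + f u
        d≤ = ℕₚ.≤-trans (ℕₚ.m∸n≤m (toℕ i) (toℕ j)) (ℕₚ.<⇒≤ (Finₚ.toℕ<n i))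
        same-token : + 2 ℤ.* ⌜ u ⌝ ℤ.+ + (toℕ j + d) ≡ + 2 ℤ.* ⌜ v ⌝ ℤ.+ + toℕ j [mod N ]
        same-token = subst (λ k → + 2 ℤ.* ⌜ u ⌝ ℤ.+ + k ≡ + 2 ℤ.* ⌜ v ⌝ ℤ.+ + toℕ j [mod N ])
                           (sym (ℕₚ.m+[n∸m]≡n j≤i)) (residue-≡⇒≡[mod] uᵢ≡vⱼ)
        close : dist u v ≤ f u
        close = overlap⇒dist≤ {u} {v} (toℕ j) d d≤ same-token

      blocks-disjoint : ∀ {u v} → u ≢ v → Disjoint (block u) (block v)
      blocks-disjoint {u} {v} u≢v (t∈u , t∈v) with ∈-tabulate⁻ t∈u | ∈-tabulate⁻ t∈v
      ... | i , refl | j , uᵢ≡vⱼ with ℕₚ.≤-total (toℕ j) (toℕ i)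
      ... | inj₁ j≤i = token-≢ u≢v i j j≤i uᵢ≡vⱼ
      ... | inj₂ i≤j = token-≢ (≢-sym u≢v) j i i≤j (sym uᵢ≡vⱼ)

      tokens-unique : Unique (concatMap block (allFin N))
      tokens-unique = Uniqueₚ.concat⁺
        (Allₚ.map⁺ (All.universal (λ u → Uniqueₚ.tabulate⁺ (token-injective u)) (allFin N)))
        (AllPairsₚ.map⁺ (AllPairs.map blocks-disjoint (Uniqueₚ.allFin⁺ N)))

      length-tokens : ∀ us → length (concatMap block us) ≡ sum (map f us) + sum (map f us)
      length-tokens []       = refl
      length-tokens (u ∷ us) = begin
        length (block u ++ concatMap block us)            ≡⟨ Listₚ.length-++ (block u) ⟩
        length (block u) + length (concatMap block us)    ≡⟨ cong₂ _+_ (Listₚ.length-tabulate (token u))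
                                                                        (length-tokens us) ⟩
        (f u + f u) + (sum (map f us) + sum (map f us))   ≡⟨ interchange (f u) (f u) _ _ ⟩
        (f u + sum (map f us)) + (f u + sum (map f us))   ∎
        where open ≡-Reasoning

      cost≤m : cost N f ≤ m
      cost≤m = begin
        cost N f                          ≡⟨ ℕₚ.n≡⌊n+n/2⌋ (cost N f) ⟩
        ⌊ cost N f + cost N f /2⌋         ≤⟨ ℕₚ.⌊n/2⌋-mono 2cost≤N ⟩
        ⌊ N /2⌋                           ≡⟨ ℕₚ.n≡⌈n+n/2⌉ m ⟨
        m                                 ∎
        where
        open ℕₚ.≤-Reasoning
        2cost≤N : cost N f + cost N f ≤ N
        2cost≤N = subst (_≤ N) (length-tokens (allFin N)) (Unique⇒length≤ tokens-unique)

    isBroadcastIndepNumber : IsBroadcastIndepNumber N bs m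
    isBroadcastIndepNumber = (m-at-v₀ , m-at-v₀-indep , cost-m-at-v₀) , λ f indep → cost≤m indep

  generates-1,a : Generates1a (+ 1 ∷ + a ∷ [])
  generates-1,a = record
    { step-1 = + 1 , here refl , ≡[mod]-refl
    ; step-a = + a , there (here refl) , ≡[mod]-refl
    ; steps  = λ where (here refl)         → inj₁ ≡[mod]-refl
                       (there (here refl)) → inj₂ ≡[mod]-refl
    }

  generates-1,-m : Generates1a (+ 1 ∷ - (+ m) ∷ [])
  generates-1,-m = record
    { step-1 = + 1 , here refl , ≡[mod]-refl
    ; step-a = - (+ m) , there (here refl) , -m≡a
    ; steps  = λ where (here refl)         → inj₁ ≡[mod]-refl
                       (there (here refl)) → inj₂ -m≡a
    }

2[1+m]∸1≡1+m+m : ∀ m → 2 * suc m ∸ 1 ≡ suc (m + m)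
2[1+m]∸1≡1+m+m m = trans (ℕₚ.+-suc m (m + 0)) (cong (λ k → suc (m + k)) (ℕₚ.+-identityʳ m))

[1+m+m]/2≡m : ∀ m → suc (m + m) / 2 ≡ m
[1+m+m]/2≡m zero    = refl
[1+m+m]/2≡m (suc m) = begin
  suc (suc m + suc m) / 2 ≡⟨ m/n≡1+[m∸n]/n {suc (suc m + suc m)} {2} (s≤s (s≤s z≤n)) ⟩
  suc ((m + suc m) / 2)   ≡⟨ cong suc (/-congˡ {o = 2} (ℕₚ.+-suc m m)) ⟩
  suc (suc (m + m) / 2)   ≡⟨ cong suc ([1+m+m]/2≡m m) ⟩
  suc m                   ∎
  where open ≡-Reasoning

corollary6 : ∀ (a : ℕ) → 2 ≤ a →
    IsBroadcastIndepNumber (2 * a ∸ 1) (+ 1 ∷ + a ∷ []) ((2 * a ∸ 1) / 2) ×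
    IsBroadcastIndepNumber (2 * a ∸ 1) (+ 1 ∷ - (+ (a ∸ 1)) ∷ []) ((2 * a ∸ 1) / 2) ×
    IsDiam (2 * a ∸ 1) (+ 1 ∷ + a ∷ []) ((2 * a ∸ 1) / 2)
corollary6 zero ()
corollary6 (suc m) _ rewrite 2[1+m]∸1≡1+m+m m | [1+m+m]/2≡m m =
  Graph.isBroadcastIndepNumber generates-1,a ,
  Graph.isBroadcastIndepNumber generates-1,-m ,
  Graph.isDiam generates-1,a
  where open Circulant m
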